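{- Let $D$ be a Dyck path with area sequence $[c_0,\dots,c_N]$ and let $j$ be an integer. Then $D$ has a rectangle at $(i+1,j)$ for some $i$ if and only if $\mathrm{LK}(D)$ has a return at position $j+1$ which is not the final step of a $1$-hill; moreover, whenever $D$ has a rectangle at $(i+1,j)$, one has $j+1=i+c_i$.
   Context: Lattice paths use horizontal steps $(x,y)\to(x,y+1)$ and vertical steps $(x,y)\to(x+1,y)$. A Dyck path of semilength $N$ goes from $(0,0)$ to $(N,N)$ staying in $y\ge x$; its area sequence is $c_k=h_k-k+1$ ($0\le k\le N$), where $h_k$ is the largest $y$ with $(k,y)$ on the path. A valley at $(x,y)$ is a vertical step ending at $(x,y)$ immediately followed by a horizontal step. A rectangle at $(i+1,j)$ is a valley at $(i+1,j)$ such that the next valley of the path (if any) has $x$-coordinate strictly larger than $j+1$. A return at position $p$ is a vertical step with final point $(p,p)$. A $1$-hill at position $q$ is the pair of steps $(q,q)\to(q,q+1)\to(q+1,q+1)$; its final step is the vertical one. A double rise with midpoint $(x,y)$: consecutive horizontal steps $(x,y-1)\to(x,y)\to(x,y+1)$; a double fall with midpoint $(x,y)$: consecutive vertical steps $(x-1,y)\to(x,y)\to(x+1,y)$. Lalanne–Kreweras involution: if $r_1<\dots<r_m$ are the $y$-coordinates of the midpoints of the double rises of $D$ and $f_1<\dots<f_m$ the $x$-coordinates of the midpoints of its double falls, then $\mathrm{LK}(D)$ is the unique Dyck path of semilength $N$ whose valleys are exactly $(r_t,f_t)$, $1\le t\le m$. -}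

module Defs where

open import Data.Nat using (ℕ; zero; suc; _+_; _≤_; _<_)
open import Data.Bool using (Bool; true; false; _∧_)
open import Data.List using (List; []; _∷_; take; drop; filter; map; zip; length; upTo)
open import Data.Maybe using (Maybe; just; nothing)
open import Data.Product using (_×_; _,_; proj₁; proj₂; Σ; ∃)
open import Relation.Nullary using (¬_)
open import Relation.Binary.PropositionalEquality using (_≡_)
open import Data.List.Membership.Propositional using (_∈_)

-- A lattice path is a word in two letters.
--   H : horizontal step (x , y) → (x , y + 1)
--   V : vertical step   (x , y) → (x + 1 , y)
data Step : Set where
  H V : Step

isH : Step → Bool
isH H = true
isH V = false

isV : Step → Bool
isV H = false
isV V = true

countH : List Step → ℕ
countH []      = 0
countH (H ∷ w) = suc (countH w)
countH (V ∷ w) = countH w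

countV : List Step → ℕ
countV []      = 0
countV (H ∷ w) = countV w
countV (V ∷ w) = suc (countV w)

pt : List Step → ℕ → ℕ × ℕ
pt w k = countV (take k w) , countH (take k w)

at : List Step → ℕ → Maybe Step
at []      _       = nothing
at (s ∷ w) zero    = just s
at (s ∷ w) (suc k) = at w k

Dyck : ℕ → List Step → Set
Dyck N w = countH w ≡ N × countV w ≡ N × (∀ k → proj₁ (pt w k) ≤ proj₂ (pt w k))

OnPath : List Step → ℕ → ℕ → Set
OnPath w x y = Σ ℕ λ t → t ≤ length w × pt w t ≡ (x , y)

IsMaxHeight : List Step → ℕ → ℕ → Set
IsMaxHeight w k h = OnPath w k h × (∀ y → OnPath w k y → y ≤ h)

-- c is the area sequence [c_0, …, c_N] of w:  c_k = h_k − k + 1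
-- (stated additively; note h_k ≥ k for Dyck paths).
AreaSeq : ℕ → List Step → (ℕ → ℕ) → Set
AreaSeq N w c = ∀ k → k ≤ N → Σ ℕ λ h → IsMaxHeight w k h × c k + k ≡ h + 1

ValleyIdx : List Step → ℕ → Set
ValleyIdx w k = at w k ≡ just V × at w (suc k) ≡ just H

Valley : List Step → ℕ → ℕ → Set
Valley w x y = Σ ℕ λ k → ValleyIdx w k × pt w (suc k) ≡ (x , y)

Rect : List Step → ℕ → ℕ → Set
Rect w x y =
  Σ ℕ λ k → ValleyIdx w k × pt w (suc k) ≡ (x , y) ×
    (∀ k' → k < k' → ValleyIdx w k' →
       (∀ k'' → k < k'' → k'' < k' → ¬ ValleyIdx w k'') →
       suc y < proj₁ (pt w (suc k')))

OneHillEndIdx : List Step → ℕ → Set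
OneHillEndIdx w m =
  at w m ≡ just H × at w (suc m) ≡ just V ×
  Σ ℕ λ q → pt w m ≡ (q , q)

ReturnNotHillEnd : List Step → ℕ → Set
ReturnNotHillEnd w p =
  Σ ℕ λ k → at w k ≡ just V × pt w (suc k) ≡ (p , p) ×
    ¬ (Σ ℕ λ m → suc m ≡ k × OneHillEndIdx w m)

isDR : List Step → ℕ → Bool
isDR w k with at w k | at w (suc k)
... | just H | just H = true
... | _      | _      = false

isDF : List Step → ℕ → Bool
isDF w k with at w k | at w (suc k)
... | just V | just V = true
... | _      | _      = false

-- r_1 < … < r_m : y-coordinates of the midpoints of the double rises
-- (listed in path order, which is increasing order).
riseYs : List Step → List ℕ
riseYs w = map (λ k → proj₂ (pt w (suc k))) (filter (λ k → Data.Bool.T? (isDR w k)) (upTo (length w)))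
  where import Data.Bool

fallXs : List Step → List ℕ
fallXs w = map (λ k → proj₁ (pt w (suc k))) (filter (λ k → Data.Bool.T? (isDF w k)) (upTo (length w)))
  where import Data.Bool

-- E is LK(D): the (unique) Dyck path of semilength N whose valleys are
-- exactly the points (r_t , f_t), 1 ≤ t ≤ m.
IsLK : ℕ → List Step → List Step → Set
IsLK N D E = Dyck N E × (∀ x y → (Valley E x y → (x , y) ∈ zip (riseYs D) (fallXs D))
                                × ((x , y) ∈ zip (riseYs D) (fallXs D) → Valley E x y))

module Submission where

-- Both sides are reduced to one condition on j and a set S of points: j ≥ 1,
-- j < N, no point of S has x-coordinate j, and either j + 1 = N or
-- (j + 1, j + 1) ∈ S. For S the valleys of E it says that E has a return at j + 1
-- not ending a 1-hill. For S the LK pairs (r_t, f_t) of D it says that D has a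
-- rectangle (i + 1, j): the H step leaving the valley continues into a double rise
-- at height j + 1, the path enters x = j + 1 by a double fall, and these have the
-- same rank t. Ranks are compared through the run decomposition: after q + 1
-- steps the height is #double rises + #valleys + 1 and, after a V step, the width
-- is #double falls + #valleys + 1, so a rise and a fall at the same coordinate
-- have the same rank iff no valley lies between them. Finally the left end (i, j)
-- of a valley is the top of column i, whence c_i = j + 1 - i.

open import Defs
open import Data.Nat using (ℕ; zero; suc; _+_; _≤_; _<_; _<?_; _≟_; z≤n; s≤s; s≤s⁻¹; s<s)
open import Data.Nat.Properties
open import Data.Bool using (Bool; true; false; T; T?)
open import Data.Unit using (tt)
open import Data.List using (List; []; _∷_; _++_; [_]; _∷ʳ_; filter; length; upTo; map; zip; take)
open import Data.List.Properties using (upTo-∷ʳ; filter-++; filter-accept; filter-reject; ++-identityʳ; length-++)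
open import Data.List.Membership.Propositional using (_∈_)
open import Data.List.Relation.Unary.Any using (here; there)
open import Data.Maybe using (Maybe; just; nothing)
open import Data.Maybe.Properties using (just-injective)
open import Data.Product using (_×_; _,_; proj₁; proj₂; Σ; ∃-syntax)
open import Data.Sum using (_⊎_; inj₁; inj₂)
import Data.Sum
open import Data.Empty using (⊥; ⊥-elim)
open import Function.Bundles using (_⇔_; mk⇔; Equivalence)
open import Function.Construct.Composition using (_⇔-∘_)
open import Function.Construct.Symmetry using (⇔-sym)
open import Relation.Nullary using (¬_; Dec; yes; no)
open import Relation.Nullary.Decidable using (_×-dec_)
import Relation.Nullary.Decidable as Dec
open import Relation.Unary using (Decidable)
open import Relation.Binary.PropositionalEquality hiding ([_])
open import Relation.Binary.Definitions using (tri<; tri≈; tri>)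
open import Algebra.Properties.CommutativeSemigroup +-commutativeSemigroup using (x∙yz≈y∙xz)

infix 4 _[_]=_

data _[_]=_ {A : Set} : List A → ℕ → A → Set where
  here  : ∀ {x xs} → x ∷ xs [ 0 ]= x
  there : ∀ {x xs t y} → xs [ t ]= y → x ∷ xs [ suc t ]= y

module _ {A : Set} where

  []=-++⁺ˡ : ∀ {xs ys : List A} {t y} → xs [ t ]= y → xs ++ ys [ t ]= y
  []=-++⁺ˡ here      = here
  []=-++⁺ˡ (there p) = there ([]=-++⁺ˡ p)

  []=-∷ʳ : ∀ (xs : List A) x → xs ∷ʳ x [ length xs ]= x
  []=-∷ʳ []       x = here
  []=-∷ʳ (_ ∷ xs) x = there ([]=-∷ʳ xs x)

  []=-∷ʳ⁻ : ∀ (xs : List A) {x t y} → xs ∷ʳ x [ t ]= y → xs [ t ]= y ⊎ (t ≡ length xs × y ≡ x)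
  []=-∷ʳ⁻ []       here         = inj₂ (refl , refl)
  []=-∷ʳ⁻ (_ ∷ xs) here         = inj₁ here
  []=-∷ʳ⁻ (_ ∷ xs) (there p) with []=-∷ʳ⁻ xs p
  ... | inj₁ q          = inj₁ (there q)
  ... | inj₂ (t≡ , y≡) = inj₂ (cong suc t≡ , y≡)

  []=-length : ∀ (xs : List A) {t} → t < length xs → ∃[ x ] xs [ t ]= x
  []=-length (x ∷ xs) {zero}  _   = x , here
  []=-length (_ ∷ xs) {suc t} t<n = let y , p = []=-length xs (s≤s⁻¹ t<n) in y , there p

  module _ {B : Set} where

    []=-map⁺ : ∀ (f : A → B) {xs t x} → xs [ t ]= x → map f xs [ t ]= f x
    []=-map⁺ f here      = here
    []=-map⁺ f (there p) = there ([]=-map⁺ f p)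

    []=-map⁻ : ∀ (f : A → B) (xs : List A) {t y} → map f xs [ t ]= y → ∃[ x ] xs [ t ]= x × y ≡ f x
    []=-map⁻ f (x ∷ xs) here      = x , here , refl
    []=-map⁻ f (x ∷ xs) (there p) = let z , q , e = []=-map⁻ f xs p in z , there q , e

    ∈-zip⁺ : ∀ {xs : List A} {ys : List B} {t x y} → xs [ t ]= x → ys [ t ]= y → (x , y) ∈ zip xs ys
    ∈-zip⁺ here      here      = here refl
    ∈-zip⁺ (there p) (there q) = there (∈-zip⁺ p q)

    ∈-zip⁻ : ∀ (xs : List A) (ys : List B) {x y} → (x , y) ∈ zip xs ys → ∃[ t ] xs [ t ]= x × ys [ t ]= y
    ∈-zip⁻ (_ ∷ xs) (_ ∷ ys) (here refl) = 0 , here , here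
    ∈-zip⁻ (_ ∷ xs) (_ ∷ ys) (there p)   = let t , q , r = ∈-zip⁻ xs ys p in suc t , there q , there r

module _ {P : ℕ → Set} (P? : Decidable P) where

  least : ∀ n → ∃[ m ] m < n × P m → ∃[ m ] m < n × P m × (∀ {m′} → m′ < m → ¬ P m′)
  least (suc n) (m , m<1+n , Pm) with anyUpTo? P? n
  ... | yes below = let l , l<n , Pl , min = least n below in l , m≤n⇒m≤1+n l<n , Pl , min
  ... | no ¬below with m≤n⇒m<n∨m≡n (s≤s⁻¹ m<1+n)
  ...   | inj₁ m<n  = ⊥-elim (¬below (m , m<n , Pm))
  ...   | inj₂ refl = m , ≤-refl , Pm , λ m′<m Pm′ → ¬below (_ , m′<m , Pm′)

-- If P k, then k is the element of filter P? (upTo n) at index rank k: the t of r_t and f_t.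
module Rank {P : ℕ → Set} (P? : Decidable P) where

  rank : ℕ → ℕ
  rank n = length (filter P? (upTo n))

  filter-upTo-suc : ∀ n → filter P? (upTo (suc n)) ≡ filter P? (upTo n) ++ filter P? [ n ]
  filter-upTo-suc n = trans (cong (filter P?) (sym (upTo-∷ʳ n))) (filter-++ P? (upTo n) [ n ])

  filter-upTo-accept : ∀ {n} → P n → filter P? (upTo (suc n)) ≡ filter P? (upTo n) ∷ʳ n
  filter-upTo-accept {n} Pn = trans (filter-upTo-suc n) (cong (filter P? (upTo n) ++_) (filter-accept P? Pn))

  filter-upTo-reject : ∀ {n} → ¬ P n → filter P? (upTo (suc n)) ≡ filter P? (upTo n)
  filter-upTo-reject {n} ¬Pn = begin
    filter P? (upTo (suc n))              ≡⟨ filter-upTo-suc n ⟩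
    filter P? (upTo n) ++ filter P? [ n ] ≡⟨ cong (filter P? (upTo n) ++_) (filter-reject P? ¬Pn) ⟩
    filter P? (upTo n) ++ []              ≡⟨ ++-identityʳ _ ⟩
    filter P? (upTo n)                    ∎
    where open ≡-Reasoning

  rank-accept : ∀ {n} → P n → rank (suc n) ≡ suc (rank n)
  rank-accept {n} Pn = begin
    rank (suc n)                              ≡⟨ cong length (filter-upTo-accept Pn) ⟩
    length (filter P? (upTo n) ++ [ n ])      ≡⟨ length-++ (filter P? (upTo n)) ⟩
    rank n + 1                                ≡⟨ +-comm (rank n) 1 ⟩
    suc (rank n)                              ∎
    where open ≡-Reasoning

  rank-reject : ∀ {n} → ¬ P n → rank (suc n) ≡ rank n
  rank-reject ¬Pn = cong length (filter-upTo-reject ¬Pn)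

  rank-≤-suc : ∀ n → rank n ≤ rank (suc n)
  rank-≤-suc n with P? n
  ... | yes Pn = ≤-trans (n≤1+n _) (≤-reflexive (sym (rank-accept Pn)))
  ... | no ¬Pn = ≤-reflexive (sym (rank-reject ¬Pn))

  rank-mono : ∀ {m n} → m ≤ n → rank m ≤ rank n
  rank-mono {n = zero}  z≤n = ≤-refl
  rank-mono {m} {suc n} m≤1+n with m≤n⇒m<n∨m≡n m≤1+n
  ... | inj₁ m<1+n = ≤-trans (rank-mono (s≤s⁻¹ m<1+n)) (rank-≤-suc n)
  ... | inj₂ refl  = ≤-refl

  rank-< : ∀ {k n} → k < n → P k → rank k < rank n
  rank-< k<n Pk = ≤-trans (≤-reflexive (sym (rank-accept Pk))) (rank-mono k<n)

  filter-upTo-[]=⁻ : ∀ n {t k} → filter P? (upTo n) [ t ]= k → k < n × P k × rank k ≡ t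
  filter-upTo-[]=⁻ (suc n) p with P? n
  ... | no ¬Pn rewrite filter-upTo-reject ¬Pn =
    let k<n , Pk , r = filter-upTo-[]=⁻ n p in m≤n⇒m≤1+n k<n , Pk , r
  ... | yes Pn rewrite filter-upTo-accept Pn with []=-∷ʳ⁻ (filter P? (upTo n)) p
  ...   | inj₁ q           = let k<n , Pk , r = filter-upTo-[]=⁻ n q in m≤n⇒m≤1+n k<n , Pk , r
  ...   | inj₂ (refl , refl) = ≤-refl , Pn , refl

  filter-upTo-[]=⁺ : ∀ n {k} → k < n → P k → filter P? (upTo n) [ rank k ]= k
  filter-upTo-[]=⁺ (suc n) {k} k<1+n Pk with m≤n⇒m<n∨m≡n (s≤s⁻¹ k<1+n) | P? n
  ... | inj₁ k<n  | yes Pn rewrite filter-upTo-accept Pn = []=-++⁺ˡ (filter-upTo-[]=⁺ n k<n Pk)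
  ... | inj₁ k<n  | no ¬Pn rewrite filter-upTo-reject ¬Pn = filter-upTo-[]=⁺ n k<n Pk
  ... | inj₂ refl | yes Pn rewrite filter-upTo-accept Pn = []=-∷ʳ (filter P? (upTo n)) n
  ... | inj₂ refl | no ¬Pn = ⊥-elim (¬Pn Pk)

  rank-constant : ∀ {m n} → m ≤ n → (∀ {l} → m ≤ l → l < n → ¬ P l) → rank m ≡ rank n
  rank-constant {n = zero}  z≤n _ = refl
  rank-constant {m} {suc n} m≤1+n none with m≤n⇒m<n∨m≡n m≤1+n
  ... | inj₂ refl = refl
  ... | inj₁ m<1+n = let m≤n = s≤s⁻¹ m<1+n in
    trans (rank-constant m≤n λ m≤l l<n → none m≤l (m≤n⇒m≤1+n l<n)) (sym (rank-reject (none m≤n ≤-refl)))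

  rank-surjective : ∀ n {t} → t < rank n → ∃[ k ] k < n × P k × rank k ≡ t
  rank-surjective n t<r = let k , p = []=-length (filter P? (upTo n)) t<r in k , filter-upTo-[]=⁻ n p

_≟ₛ_ : (s t : Step) → Dec (s ≡ t)
H ≟ₛ H = yes refl
V ≟ₛ V = yes refl
H ≟ₛ V = no λ ()
V ≟ₛ H = no λ ()

indicator : Step → Maybe Step → ℕ
indicator _ nothing  = 0
indicator H (just H) = 1
indicator V (just V) = 1
indicator H (just V) = 0
indicator V (just H) = 0

indicator-self : ∀ s → indicator s (just s) ≡ 1
indicator-self H = refl
indicator-self V = refl

indicator-other : ∀ {s t} → t ≢ s → indicator s (just t) ≡ 0
indicator-other {H} {H} t≢s = ⊥-elim (t≢s refl)
indicator-other {H} {V} _   = refl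
indicator-other {V} {H} _   = refl
indicator-other {V} {V} t≢s = ⊥-elim (t≢s refl)

at-end-suc : ∀ w {m} → at w m ≡ nothing → at w (suc m) ≡ nothing
at-end-suc []      _  = refl
at-end-suc (_ ∷ w) {suc m} e = at-end-suc w {m} e

at-end-mono : ∀ w {m n} → m ≤ n → at w m ≡ nothing → at w n ≡ nothing
at-end-mono []      _         _ = refl
at-end-mono (_ ∷ w) (s≤s m≤n) e = at-end-mono w m≤n e

at-length : ∀ w → at w (length w) ≡ nothing
at-length []      = refl
at-length (_ ∷ w) = at-length w

at-< : ∀ w {m s} → at w m ≡ just s → m < length w
at-< (_ ∷ w) {zero}  _ = s≤s z≤n
at-< (_ ∷ w) {suc m} e = s≤s (at-< w e)

take-end : ∀ w {m} → at w m ≡ nothing → take m w ≡ w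
take-end []      {zero}  _ = refl
take-end []      {suc m} _ = refl
take-end (s ∷ w) {suc m} e = cong (s ∷_) (take-end w e)

-- For s = H (resp. V), prefix w m is the y- (resp. x-)coordinate of pt w m.
module PrefixCount (s : Step) (count : List Step → ℕ) (count-[] : count [] ≡ 0)
                   (count-∷ : ∀ t w → count (t ∷ w) ≡ indicator s (just t) + count w) where

  prefix : List Step → ℕ → ℕ
  prefix w m = count (take m w)

  prefix-suc : ∀ w m → prefix w (suc m) ≡ indicator s (at w m) + prefix w m
  prefix-suc []      zero    = refl
  prefix-suc []      (suc _) = refl
  prefix-suc (t ∷ w) zero    = count-∷ t []
  prefix-suc (t ∷ w) (suc m) = begin
    count (t ∷ take (suc m) w)                                     ≡⟨ count-∷ t _ ⟩
    indicator s (just t) + prefix w (suc m)                        ≡⟨ cong (indicator s (just t) +_) (prefix-suc w m) ⟩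
    indicator s (just t) + (indicator s (at w m) + prefix w m)     ≡⟨ x∙yz≈y∙xz (indicator s (just t)) (indicator s (at w m)) (prefix w m) ⟩
    indicator s (at w m) + (indicator s (just t) + prefix w m)     ≡⟨ cong (indicator s (at w m) +_) (sym (count-∷ t _)) ⟩
    indicator s (at w m) + count (t ∷ take m w)                    ∎
    where open ≡-Reasoning

  prefix-step : ∀ w m {x} → at w m ≡ x → prefix w (suc m) ≡ indicator s x + prefix w m
  prefix-step w m refl = prefix-suc w m

  prefix-step-self : ∀ w m → at w m ≡ just s → prefix w (suc m) ≡ suc (prefix w m)
  prefix-step-self w m e = trans (prefix-step w m e) (cong (_+ prefix w m) (indicator-self s))

  prefix-mono : ∀ w {m n} → m ≤ n → prefix w m ≤ prefix w n
  prefix-mono []      {zero}  {zero}  _ = ≤-refl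
  prefix-mono []      {zero}  {suc _} _ = ≤-refl
  prefix-mono []      {suc _} {suc _} _ = ≤-refl
  prefix-mono (t ∷ w) {zero} _ = ≤-trans (≤-reflexive count-[]) z≤n
  prefix-mono (t ∷ w) {suc m} {suc n} (s≤s m≤n) =
    subst₂ _≤_ (sym (count-∷ t _)) (sym (count-∷ t _)) (+-monoʳ-≤ _ (prefix-mono w m≤n))

  prefix-≤-count : ∀ w m → prefix w m ≤ count w
  prefix-≤-count []      zero    = ≤-refl
  prefix-≤-count []      (suc _) = ≤-refl
  prefix-≤-count (t ∷ w) zero    = ≤-trans (≤-reflexive count-[]) z≤n
  prefix-≤-count (t ∷ w) (suc m) =
    subst₂ _≤_ (sym (count-∷ t _)) (sym (count-∷ t _)) (+-monoʳ-≤ _ (prefix-≤-count w m))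

  prefix-end : ∀ w {m} → at w m ≡ nothing → prefix w m ≡ count w
  prefix-end w e = cong count (take-end w e)

  prefix-< : ∀ w {a b} → at w a ≡ just s → a < b → prefix w a < prefix w b
  prefix-< w {a} e a<b = ≤-trans (≤-reflexive (sym (prefix-step-self w a e))) (prefix-mono w a<b)

  prefix-<⇒< : ∀ w {a b} → prefix w a < prefix w b → a < b
  prefix-<⇒< w lt = ≰⇒> λ b≤a → <⇒≱ lt (prefix-mono w b≤a)

  prefix-injective : ∀ w {a b} → at w a ≡ just s → at w b ≡ just s → prefix w a ≡ prefix w b → a ≡ b
  prefix-injective w {a} {b} ea eb eq with <-cmp a b
  ... | tri< a<b _ _ = ⊥-elim (<⇒≢ (prefix-< w ea a<b) eq)
  ... | tri≈ _ a≡b _ = a≡b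
  ... | tri> _ _ b<a = ⊥-elim (<⇒≢ (prefix-< w eb b<a) (sym eq))

  prefix-surjective : ∀ w {y} → y < count w → ∃[ q ] at w q ≡ just s × prefix w q ≡ y
  prefix-surjective []      {y} y<c = ⊥-elim (n≮0 (subst (y <_) count-[] y<c))
  prefix-surjective (t ∷ w) {y} y<c with t ≟ₛ s
  ... | no t≢s =
    let q , e , p = prefix-surjective w (subst (y <_) (trans (count-∷ t w) (cong (_+ count w) (indicator-other t≢s))) y<c)
    in suc q , e , trans (count-∷ t _) (trans (cong (_+ prefix w q) (indicator-other t≢s)) p)
  ... | yes refl = after-s y (subst (y <_) (trans (count-∷ t w) (cong (_+ count w) (indicator-self t))) y<c)
    where
    after-s : ∀ y → y < suc (count w) → ∃[ q ] at (t ∷ w) q ≡ just t × prefix (t ∷ w) q ≡ y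
    after-s zero    _             = 0 , refl , count-[]
    after-s (suc y) (s<s y<count) =
      let q , e , p = prefix-surjective w y<count
      in suc q , e , trans (count-∷ t _) (trans (cong (_+ prefix w q) (indicator-self t)) (cong suc p))

countH-∷ : ∀ t w → countH (t ∷ w) ≡ indicator H (just t) + countH w
countH-∷ H _ = refl
countH-∷ V _ = refl

countV-∷ : ∀ t w → countV (t ∷ w) ≡ indicator V (just t) + countV w
countV-∷ H _ = refl
countV-∷ V _ = refl

module Hs = PrefixCount H countH refl countH-∷
module Vs = PrefixCount V countV refl countV-∷

hs vs : List Step → ℕ → ℕ
hs = Hs.prefix
vs = Vs.prefix

V-step-start : ∀ w k {x y} → at w k ≡ just V → pt w (suc k) ≡ (suc x , y) → pt w k ≡ (x , y)
V-step-start w k e p =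
  cong₂ _,_ (suc-injective (trans (sym (Vs.prefix-step-self w k e)) (cong proj₁ p))) (trans (sym (Hs.prefix-step w k e)) (cong proj₂ p))

H-step-start : ∀ w k {x y} → at w k ≡ just H → pt w (suc k) ≡ (x , suc y) → pt w k ≡ (x , y)
H-step-start w k e p =
  cong₂ _,_ (trans (sym (Vs.prefix-step w k e)) (cong proj₁ p)) (suc-injective (trans (sym (Hs.prefix-step-self w k e)) (cong proj₂ p)))

bit : Bool → ℕ
bit false = 0
bit true  = 1

module BoolRank (p : ℕ → Bool) where
  open Rank (λ n → T? (p n)) public

  rank-suc : ∀ n → rank (suc n) ≡ bit (p n) + rank n
  rank-suc n with p n in e
  ... | true  = rank-accept (subst T (sym e) tt)
  ... | false = rank-reject (subst T e)

DoubleRise DoubleFall : List Step → ℕ → Set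
DoubleRise w k = at w k ≡ just H × at w (suc k) ≡ just H
DoubleFall w k = at w k ≡ just V × at w (suc k) ≡ just V

isValley : List Step → ℕ → Bool
isValley w k with at w k | at w (suc k)
... | just V | just H = true
... | _      | _      = false

isDR⇔ : ∀ w k → T (isDR w k) ⇔ DoubleRise w k
isDR⇔ w k = mk⇔ to from
  where
  to : T (isDR w k) → DoubleRise w k
  to t with at w k | at w (suc k)
  ... | just H | just H  = refl , refl
  ... | just H | just V  = ⊥-elim t
  ... | just H | nothing = ⊥-elim t
  ... | just V | _       = ⊥-elim t
  ... | nothing | _      = ⊥-elim t
  from : DoubleRise w k → T (isDR w k)
  from (e₁ , e₂) rewrite e₁ | e₂ = tt

isDF⇔ : ∀ w k → T (isDF w k) ⇔ DoubleFall w k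
isDF⇔ w k = mk⇔ to from
  where
  to : T (isDF w k) → DoubleFall w k
  to t with at w k | at w (suc k)
  ... | just V | just V  = refl , refl
  ... | just V | just H  = ⊥-elim t
  ... | just V | nothing = ⊥-elim t
  ... | just H | _       = ⊥-elim t
  ... | nothing | _      = ⊥-elim t
  from : DoubleFall w k → T (isDF w k)
  from (e₁ , e₂) rewrite e₁ | e₂ = tt

isValley⇔ : ∀ w k → T (isValley w k) ⇔ ValleyIdx w k
isValley⇔ w k = mk⇔ to from
  where
  to : T (isValley w k) → ValleyIdx w k
  to t with at w k | at w (suc k)
  ... | just V | just H  = refl , refl
  ... | just V | just V  = ⊥-elim t
  ... | just V | nothing = ⊥-elim t
  ... | just H | _       = ⊥-elim t
  ... | nothing | _      = ⊥-elim t
  from : ValleyIdx w k → T (isValley w k)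
  from (e₁ , e₂) rewrite e₁ | e₂ = tt

valleyIdx? : ∀ w → Decidable (ValleyIdx w)
valleyIdx? w k = Dec.map (isValley⇔ w k) (T? (isValley w k))

H≢V : H ≢ V
H≢V ()

step-unique : ∀ w k {s t} → at w k ≡ just s → at w k ≡ just t → s ≡ t
step-unique _ _ e₁ e₂ = just-injective (trans (sym e₁) e₂)

at-defined : ∀ w {m n s} → m ≤ n → at w n ≡ just s → ∃[ t ] at w m ≡ just t
at-defined w {m} m≤n e with at w m in eₘ
... | just t  = t , refl
... | nothing with () ← trans (sym (at-end-mono w m≤n eₘ)) e

valley-between : ∀ w {m n} → at w m ≡ just V → at w n ≡ just H → m < n → ∃[ v ] m ≤ v × v < n × ValleyIdx w v
valley-between w {m} {suc n} eₘ eₙ m<1+n with at-defined w (n≤1+n n) eₙ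
... | V , e = n , s≤s⁻¹ m<1+n , ≤-refl , e , eₙ
... | H , e with m≤n⇒m<n∨m≡n (s≤s⁻¹ m<1+n)
...   | inj₂ refl = ⊥-elim (H≢V (step-unique w n e eₘ))
...   | inj₁ m<n  = let v , m≤v , v<n , valley = valley-between w eₘ e m<n in v , m≤v , m≤n⇒m≤1+n v<n , valley

IsMaxHeight-unique : ∀ {w x h h′} → IsMaxHeight w x h → IsMaxHeight w x h′ → h ≡ h′
IsMaxHeight-unique (on , max) (on′ , max′) = ≤-antisym (max′ _ on) (max _ on′)

+-cancel-⇔ : ∀ {a b c d} → a + b ≡ c + d → (a ≡ c ⇔ b ≡ d)
+-cancel-⇔ {a} {b} {c} {d} e = mk⇔
  (λ { refl → +-cancelˡ-≡ a b d e })
  (λ { refl → +-cancelʳ-≡ b a c e })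

module Runs (w : List Step) where

  module Rises   = BoolRank (isDR w)
  module Falls   = BoolRank (isDF w)
  module Valleys = BoolRank (isValley w)

  rises falls valleys : ℕ → ℕ
  rises   = Rises.rank
  falls   = Falls.rank
  valleys = Valleys.rank

  -- Each H-run contributes one step to the height and its other steps are double
  -- rises; the H-runs after the first one start at the valleys.
  heights : at w 0 ≡ just H → ∀ q → hs w (suc q) ≡ rises q + suc (valleys q)
  heights h₀ zero = Hs.prefix-step w 0 h₀
  heights h₀ (suc q) rewrite Hs.prefix-suc w (suc q) | Rises.rank-suc q | Valleys.rank-suc q
    with heights h₀ q
  ... | ih with at w q in e₁ | at w (suc q) in e₂
  ... | just H  | just H  = cong suc ih
  ... | just H  | just V  = ih
  ... | just H  | nothing = ih
  ... | just V  | just H  = trans (cong suc ih) (sym (+-suc _ _))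
  ... | just V  | just V  = ih
  ... | just V  | nothing = ih
  ... | nothing | nothing = ih
  ... | nothing | just _ with () ← trans (sym (at-end-suc w e₁)) e₂

  LKPair : ℕ → ℕ → Set
  LKPair x y = (x , y) ∈ zip (riseYs w) (fallXs w)

  record LKWitness (x y : ℕ) : Set where
    field
      rise fall   : ℕ
      doubleRise  : DoubleRise w rise
      doubleFall  : DoubleFall w fall
      same-rank   : rises rise ≡ falls fall
      rise-height : hs w (suc rise) ≡ x
      fall-width  : vs w (suc fall) ≡ y

  LKPair⇔LKWitness : ∀ {x y} → LKPair x y ⇔ LKWitness x y
  LKPair⇔LKWitness {x} {y} = mk⇔ to from
    where
    to : LKPair x y → LKWitness x y
    to p =
      let t , rx , fy          = ∈-zip⁻ (riseYs w) (fallXs w) p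
          k₁ , r[t] , x≡       = []=-map⁻ _ _ rx
          k₂ , f[t] , y≡       = []=-map⁻ _ _ fy
          _ , dr , rank₁       = Rises.filter-upTo-[]=⁻ (length w) r[t]
          _ , df , rank₂       = Falls.filter-upTo-[]=⁻ (length w) f[t]
      in record { rise = k₁ ; fall = k₂
                ; doubleRise = Equivalence.to (isDR⇔ w k₁) dr ; doubleFall = Equivalence.to (isDF⇔ w k₂) df
                ; same-rank = trans rank₁ (sym rank₂) ; rise-height = sym x≡ ; fall-width = sym y≡ }
    from : LKWitness x y → LKPair x y
    from record { rise = k₁ ; fall = k₂ ; doubleRise = dr ; doubleFall = df
                ; same-rank = same ; rise-height = refl ; fall-width = refl } =
      ∈-zip⁺ ([]=-map⁺ (λ k → hs w (suc k)) (Rises.filter-upTo-[]=⁺ (length w) (at-< w (proj₁ dr)) (Equivalence.from (isDR⇔ w k₁) dr)))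
             (subst (fallXs w [_]= vs w (suc k₂)) (sym same)
               ([]=-map⁺ (λ k → vs w (suc k)) (Falls.filter-upTo-[]=⁺ (length w) (at-< w (proj₁ df)) (Equivalence.from (isDF⇔ w k₂) df))))

module DyckPath {N w} (dyck : Dyck N w) where
  open Runs w

  vs≤hs : ∀ k → vs w k ≤ hs w k
  vs≤hs = proj₂ (proj₂ dyck)

  hs≤N : ∀ k → hs w k ≤ N
  hs≤N k = subst (hs w k ≤_) (proj₁ dyck) (Hs.prefix-≤-count w k)

  vs≤N : ∀ k → vs w k ≤ N
  vs≤N k = subst (vs w k ≤_) (proj₁ (proj₂ dyck)) (Vs.prefix-≤-count w k)

  hs-end : ∀ {k} → at w k ≡ nothing → hs w k ≡ N
  hs-end e = trans (Hs.prefix-end w e) (proj₁ dyck)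

  vs-end : ∀ {k} → at w k ≡ nothing → vs w k ≡ N
  vs-end e = trans (Vs.prefix-end w e) (proj₁ (proj₂ dyck))

  H-step-at : ∀ {y} → y < N → ∃[ q ] at w q ≡ just H × hs w q ≡ y
  H-step-at {y} y<N = Hs.prefix-surjective w (subst (y <_) (sym (proj₁ dyck)) y<N)

  V-step-at : ∀ {x} → x < N → ∃[ q ] at w q ≡ just V × vs w q ≡ x
  V-step-at {x} x<N = Vs.prefix-surjective w (subst (x <_) (sym (proj₁ (proj₂ dyck))) x<N)

  starts-with-H : ∀ {k s} → at w k ≡ just s → at w 0 ≡ just H
  starts-with-H e with at-defined w z≤n e
  ... | H , e₀ = e₀
  ... | V , e₀ with () ← subst₂ _≤_ (Vs.prefix-step w 0 e₀) (Hs.prefix-step w 0 e₀) (vs≤hs 1)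

  ends-with-V : ∀ {k} → at w k ≡ just H → at w (suc k) ≢ nothing
  ends-with-V {k} e end = 1+n≰n (begin
    suc (hs w k)  ≡⟨ Hs.prefix-step w k e ⟨
    hs w (suc k)  ≡⟨ hs-end end ⟩
    N             ≡⟨ vs-end end ⟨
    vs w (suc k)  ≡⟨ Vs.prefix-step w k e ⟩
    vs w k        ≤⟨ vs≤hs k ⟩
    hs w k        ∎)
    where open ≤-Reasoning

  -- Likewise the width counts double falls and V-runs; as the runs alternate, starting
  -- with H and ending with V, there are valleys q + 1 V-runs, one fewer if step q is an H.
  widths : at w 0 ≡ just H → ∀ q → indicator H (at w q) + vs w (suc q) ≡ falls q + suc (valleys q)
  widths h₀ zero rewrite h₀ = cong suc (Vs.prefix-step w 0 h₀)
  widths h₀ (suc q) rewrite Vs.prefix-suc w (suc q) | Falls.rank-suc q | Valleys.rank-suc q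
    with widths h₀ q
  ... | ih with at w q in e₁ | at w (suc q) in e₂
  ... | just H  | just H  = ih
  ... | just H  | just V  = ih
  ... | just H  | nothing = ⊥-elim (ends-with-V e₁ e₂)
  ... | just V  | just H  = trans (cong suc ih) (sym (+-suc _ _))
  ... | just V  | just V  = cong suc ih
  ... | just V  | nothing = ih
  ... | nothing | nothing = ih
  ... | nothing | just _ with () ← trans (sym (at-end-suc w e₁)) e₂

  widths-at : at w 0 ≡ just H → ∀ {q x} → at w q ≡ x → indicator H x + vs w (suc q) ≡ falls q + suc (valleys q)
  widths-at h₀ {q} refl = widths h₀ q

  rises≡falls⇔valleys≡valleys : ∀ {p q} → at w 0 ≡ just H → at w q ≡ just V → hs w (suc p) ≡ vs w (suc q) →
                                (rises p ≡ falls q ⇔ valleys p ≡ valleys q)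
  rises≡falls⇔valleys≡valleys {p} {q} h₀ e same = suc-injective⇔ ⇔-∘ +-cancel-⇔ balance
    where
    balance : rises p + suc (valleys p) ≡ falls q + suc (valleys q)
    balance = trans (sym (heights h₀ p)) (trans same (widths-at h₀ e))
    suc-injective⇔ : suc (valleys p) ≡ suc (valleys q) ⇔ valleys p ≡ valleys q
    suc-injective⇔ = mk⇔ suc-injective (cong suc)

  total-rises≡total-falls : at w 0 ≡ just H → rises (length w) ≡ falls (length w)
  total-rises≡total-falls h₀ = +-cancelʳ-≡ (suc (valleys L)) (rises L) (falls L) (begin
    rises L + suc (valleys L)   ≡⟨ heights h₀ L ⟨
    hs w (suc L)                ≡⟨ hs-end (at-end-suc w (at-length w)) ⟩
    N                           ≡⟨ vs-end (at-end-suc w (at-length w)) ⟨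
    vs w (suc L)                ≡⟨ widths-at h₀ (at-length w) ⟩
    falls L + suc (valleys L)   ∎)
    where
    open ≡-Reasoning
    L : ℕ
    L = length w

  doubleRise-paired : ∀ {k} → DoubleRise w k → ∃[ y ] LKPair (hs w (suc k)) y
  doubleRise-paired {k} dr@(e , _) with Falls.rank-surjective (length w) rises-k<falls
    where
    rises-k<falls : rises k < falls (length w)
    rises-k<falls = subst (rises k <_) (total-rises≡total-falls (starts-with-H e))
                          (Rises.rank-< (at-< w e) (Equivalence.from (isDR⇔ w k) dr))
  ... | k₂ , _ , df , same = vs w (suc k₂) , Equivalence.from LKPair⇔LKWitness (record
    { rise = k ; fall = k₂ ; doubleRise = dr ; doubleFall = Equivalence.to (isDF⇔ w k₂) df
    ; same-rank = sym same ; rise-height = refl ; fall-width = refl })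

record ReturnPattern (S : ℕ → ℕ → Set) (N j : ℕ) : Set where
  field
    1≤j    : 1 ≤ j
    j<N    : j < N
    corner : suc j ≡ N ⊎ S (suc j) (suc j)
    x≢j    : ∀ y → ¬ S j y

ReturnPattern-cong : ∀ {S S′ N j} → (∀ {x y} → S x y ⇔ S′ x y) → ReturnPattern S N j ⇔ ReturnPattern S′ N j
ReturnPattern-cong {S} {S′} {N} {j} S⇔S′ = mk⇔ (transport (Equivalence.to S⇔S′) (Equivalence.from S⇔S′))
                                               (transport (Equivalence.from S⇔S′) (Equivalence.to S⇔S′))
  where
  transport : ∀ {R R′ : ℕ → ℕ → Set} → (∀ {x y} → R x y → R′ x y) → (∀ {x y} → R′ x y → R x y) →
              ReturnPattern R N j → ReturnPattern R′ N j
  transport to from p = record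
    { 1≤j = 1≤j ; j<N = j<N ; corner = Data.Sum.map₂ to corner ; x≢j = λ y r′ → x≢j y (from r′) }
    where open ReturnPattern p

module Rectangles {N D} (dyck : Dyck N D) where
  open Runs D
  open DyckPath dyck

  rect-later-valleys : ∀ {x y} ((k , _ , _ , next) : Rect D x y) →
                       ∀ {k″} → k < k″ → ValleyIdx D k″ → suc y < vs D (suc k″)
  rect-later-valleys {y = y} (k , _ , _ , next) {k″} k<k″ valley″ =
    let l , l<1+k″ , (k<l , valley) , minimal = least (λ v → (k <? v) ×-dec valleyIdx? D v) (suc k″) (k″ , ≤-refl , k<k″ , valley″)
    in ≤-trans (next l k<l valley (λ m k<m m<l valleyₘ → minimal m<l (k<m , valleyₘ)))
               (Vs.prefix-mono D (s≤s (s≤s⁻¹ l<1+k″)))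

  module RectangleAt {i j k} (vk : at D k ≡ just V) (hk : at D (suc k) ≡ just H) (point : pt D (suc k) ≡ (suc i , j))
                     (later : ∀ {k″} → k < k″ → ValleyIdx D k″ → suc j < vs D (suc k″)) where

    hs-valley : hs D (suc k) ≡ j
    hs-valley = cong proj₂ point

    vs-before : vs D k ≡ i
    vs-before = cong proj₁ (V-step-start D k vk point)

    hs-top : hs D (suc (suc k)) ≡ suc j
    hs-top = trans (Hs.prefix-step-self D (suc k) hk) (cong suc hs-valley)

    i<j : i < j
    i<j = subst₂ _≤_ (cong proj₁ point) hs-valley (vs≤hs (suc k))

    j<N : j < N
    j<N = subst (_≤ N) hs-top (hs≤N (suc (suc k)))

    x≢j : ∀ y → ¬ LKPair j y
    x≢j y p = H≢V (step-unique D k (subst (λ m → at D m ≡ just H) rise≡k (proj₁ doubleRise)) vk)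
      where
      open LKWitness (Equivalence.to LKPair⇔LKWitness p)
      rise≡k : rise ≡ k
      rise≡k = suc-injective (Hs.prefix-injective D (proj₂ doubleRise) hk (trans rise-height (sym hs-valley)))

    rise-continues : suc j < N → at D (suc (suc k)) ≡ just H
    rise-continues j+1<N with at D (suc (suc k)) in e | H-step-at j+1<N
    ... | just H  | _ = refl
    ... | nothing | _ = ⊥-elim (<⇒≢ j+1<N (trans (sym hs-top) (hs-end e)))
    ... | just V  | q₀ , hq₀ , height = ⊥-elim (valley-below-row (valley-between D e hq₀ k+2<q₀))
      where
      k+2<q₀ : suc (suc k) < q₀
      k+2<q₀ = ≤∧≢⇒< (Hs.prefix-<⇒< D (subst₂ _<_ (sym hs-valley) (sym height) (n<1+n j)))
                     λ k+2≡q₀ → H≢V (step-unique D q₀ hq₀ (subst (λ m → at D m ≡ just V) k+2≡q₀ e))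
      valley-below-row : ∃[ v ] suc (suc k) ≤ v × v < q₀ × ValleyIdx D v → ⊥
      valley-below-row (v , k+2≤v , v<q₀ , valley) = <⇒≱ (later (≤-trans (n≤1+n _) k+2≤v) valley) (begin
        vs D (suc v)  ≤⟨ Vs.prefix-mono D v<q₀ ⟩
        vs D q₀       ≤⟨ vs≤hs q₀ ⟩
        hs D q₀       ≡⟨ height ⟩
        suc j         ∎)
        where open ≤-Reasoning

    q : ℕ
    q = proj₁ (V-step-at j<N)

    vq : at D q ≡ just V
    vq = proj₁ (proj₂ (V-step-at j<N))

    vs-q : vs D q ≡ j
    vs-q = proj₂ (proj₂ (V-step-at j<N))

    vs-fall : vs D (suc q) ≡ suc j
    vs-fall = trans (Vs.prefix-step-self D q vq) (cong suc vs-q)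

    k+1<q : suc k < q
    k+1<q = ≤∧≢⇒< (Vs.prefix-<⇒< D (subst₂ _<_ (sym vs-before) (sym vs-q) i<j))
                  λ k+1≡q → H≢V (step-unique D q (subst (λ m → at D m ≡ just H) k+1≡q hk) vq)

    no-valley-before-fall : ∀ {m} → suc k ≤ m → m < q → ¬ T (isValley D m)
    no-valley-before-fall {m} k<m m<q t = <⇒≱ (later k<m (Equivalence.to (isValley⇔ D m) t)) (begin
      vs D (suc m)  ≤⟨ Vs.prefix-mono D m<q ⟩
      vs D q        ≡⟨ vs-q ⟩
      j             ≤⟨ n≤1+n j ⟩
      suc j         ∎)
      where open ≤-Reasoning

    fall-continues : suc j < N → at D (suc q) ≡ just V
    fall-continues j+1<N with at D (suc q) in e
    ... | just V  = refl
    ... | nothing = ⊥-elim (<⇒≢ j+1<N (trans (sym vs-fall) (vs-end e)))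
    ... | just H  = ⊥-elim (<⇒≢ (later (≤-trans (n≤1+n _) k+1<q) (vq , e)) (sym vs-fall))

    corner-pair : suc j < N → LKPair (suc j) (suc j)
    corner-pair j+1<N = Equivalence.from LKPair⇔LKWitness (record
      { rise = suc k ; fall = q
      ; doubleRise = hk , rise-continues j+1<N ; doubleFall = vq , fall-continues j+1<N
      ; same-rank = Equivalence.from (rises≡falls⇔valleys≡valleys (starts-with-H vk) vq (trans hs-top (sym vs-fall)))
                                     (Valleys.rank-constant (<⇒≤ k+1<q) no-valley-before-fall)
      ; rise-height = hs-top ; fall-width = vs-fall })

    return-pattern : ReturnPattern LKPair N j
    return-pattern = record { 1≤j = ≤-trans (s≤s z≤n) i<j ; j<N = j<N ; corner = corner ; x≢j = x≢j }
      where
      corner : suc j ≡ N ⊎ LKPair (suc j) (suc j)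
      corner with suc j ≟ N
      ... | yes j+1≡N = inj₁ j+1≡N
      ... | no  j+1≢N = inj₂ (corner-pair (≤∧≢⇒< j<N j+1≢N))

  rect⇒pattern : ∀ {i j} → Rect D (suc i) j → ReturnPattern LKPair N j
  rect⇒pattern r@(_ , (vk , hk) , point , _) = RectangleAt.return-pattern vk hk point (rect-later-valleys r)

  module FromPattern {j} (p : ReturnPattern LKPair N j) where
    open ReturnPattern p

    rise-into-row : ∃[ k ] at D (suc k) ≡ just H × hs D (suc k) ≡ j
    rise-into-row with H-step-at j<N
    ... | zero  , _ , 0≡j = ⊥-elim (<⇒≢ 1≤j 0≡j)
    ... | suc k , e , h≡j = k , e , h≡j

    k : ℕ
    k = proj₁ rise-into-row

    hk : at D (suc k) ≡ just H
    hk = proj₁ (proj₂ rise-into-row)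

    hs-valley : hs D (suc k) ≡ j
    hs-valley = proj₂ (proj₂ rise-into-row)

    vk : at D k ≡ just V
    vk with at-defined D (n≤1+n k) hk
    ... | V , e = e
    ... | H , e = let y , pair = doubleRise-paired (e , hk) in ⊥-elim (x≢j y (subst (λ x → LKPair x y) hs-valley pair))

    hs-top : hs D (suc (suc k)) ≡ suc j
    hs-top = trans (Hs.prefix-step-self D (suc k) hk) (cong suc hs-valley)

    module BeyondCorner (wit : LKWitness (suc j) (suc j)) where
      open LKWitness wit

      rise≡k+1 : rise ≡ suc k
      rise≡k+1 = Hs.prefix-injective D (proj₁ doubleRise) hk
        (trans (suc-injective (trans (sym (Hs.prefix-step-self D rise (proj₁ doubleRise))) rise-height)) (sym hs-valley))

      valleys-equal : valleys (suc k) ≡ valleys fall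
      valleys-equal = subst (λ r → valleys r ≡ valleys fall) rise≡k+1
        (Equivalence.to (rises≡falls⇔valleys≡valleys (starts-with-H vk) (proj₁ doubleFall) (trans rise-height (sym fall-width))) same-rank)

      later : ∀ k′ → k < k′ → ValleyIdx D k′ → (∀ k″ → k < k″ → k″ < k′ → ¬ ValleyIdx D k″) → suc j < vs D (suc k′)
      later k′ k<k′ (vk′ , hk′) none with <-cmp k′ fall
      ... | tri> _ _ fall<k′ = subst (_< vs D (suc k′)) fall-width (Vs.prefix-< D (proj₂ doubleFall) (s≤s fall<k′))
      ... | tri≈ _ refl _    = ⊥-elim (H≢V (step-unique D (suc k′) hk′ (proj₂ doubleFall)))
      -- the valley k′ would lie between the paired rise and fall
      ... | tri< k′<fall _ _ = ⊥-elim (<⇒≢ (begin-strict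
        valleys (suc k)  ≡⟨ Valleys.rank-constant k<k′ (λ {l} k<l l<k′ t → none l k<l l<k′ (Equivalence.to (isValley⇔ D l) t)) ⟩
        valleys k′       <⟨ Valleys.rank-< k′<fall (Equivalence.from (isValley⇔ D k′) (vk′ , hk′)) ⟩
        valleys fall     ∎) valleys-equal)
        where open ≤-Reasoning

    later : ∀ k′ → k < k′ → ValleyIdx D k′ → (∀ k″ → k < k″ → k″ < k′ → ¬ ValleyIdx D k″) → suc j < vs D (suc k′)
    later with corner
    ... | inj₂ pair = BeyondCorner.later (Equivalence.to LKPair⇔LKWitness pair)
    ... | inj₁ j+1≡N = λ k′ k<k′ (_ , hk′) _ → ⊥-elim (1+n≰n (begin
      suc N                     ≡⟨ cong suc (trans (sym j+1≡N) (sym hs-top)) ⟩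
      suc (hs D (suc (suc k)))  ≤⟨ s≤s (Hs.prefix-mono D (s≤s k<k′)) ⟩
      suc (hs D (suc k′))       ≡⟨ Hs.prefix-step-self D (suc k′) hk′ ⟨
      hs D (suc (suc k′))       ≤⟨ hs≤N (suc (suc k′)) ⟩
      N                         ∎))
      where open ≤-Reasoning

    rect : ∃[ i ] Rect D (suc i) j
    rect = vs D k , k , (vk , hk) , cong₂ _,_ (Vs.prefix-step-self D k vk) hs-valley , later

  V-step-column-top : ∀ {k x y} → at D k ≡ just V → pt D k ≡ (x , y) → IsMaxHeight D x y
  V-step-column-top {k} {x} {y} vk left-end = (k , <⇒≤ (at-< D vk) , left-end) , below
    where
    below : ∀ y′ → OnPath D x y′ → y′ ≤ y
    below y′ (t , _ , pt≡) = subst₂ _≤_ (cong proj₂ pt≡) (cong proj₂ left-end) (Hs.prefix-mono D t≤k)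
      where
      t≤k : t ≤ k
      t≤k = ≮⇒≥ λ k<t → 1+n≰n (begin
        suc (vs D k)  ≡⟨ Vs.prefix-step-self D k vk ⟨
        vs D (suc k)  ≤⟨ Vs.prefix-mono D k<t ⟩
        vs D t        ≡⟨ trans (cong proj₁ pt≡) (sym (cong proj₁ left-end)) ⟩
        vs D k        ∎)
        where open ≤-Reasoning

  rect-area : ∀ {c i j} → AreaSeq N D c → Rect D (suc i) j → suc j ≡ i + c i
  rect-area {c} {i} {j} area (k , (vk , _) , point , _) =
    let h , top , c+i≡h+1 = area i (subst (_≤ N) (cong proj₁ left-end) (vs≤N k)) in begin
    suc j     ≡⟨ +-comm 1 j ⟩
    j + 1     ≡⟨ cong (_+ 1) (IsMaxHeight-unique (V-step-column-top vk left-end) top) ⟩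
    h + 1     ≡⟨ c+i≡h+1 ⟨
    c i + i   ≡⟨ +-comm (c i) i ⟩
    i + c i   ∎
    where
    open ≡-Reasoning
    left-end : pt D k ≡ (i , j)
    left-end = V-step-start D k vk point

  rect⇔pattern : ∀ {j} → (∃[ i ] Rect D (suc i) j) ⇔ ReturnPattern LKPair N j
  rect⇔pattern = mk⇔ (λ (_ , r) → rect⇒pattern r) FromPattern.rect

module Returns {N E} (dyck : Dyck N E) where
  open DyckPath dyck

  H-step-not-onto-diagonal : ∀ {m} → at E m ≡ just H → vs E (suc m) ≢ hs E (suc m)
  H-step-not-onto-diagonal {m} e = <⇒≢ (begin-strict
    vs E (suc m)  ≡⟨ Vs.prefix-step E m e ⟩
    vs E m        ≤⟨ vs≤hs m ⟩
    hs E m        <⟨ n<1+n _ ⟩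
    suc (hs E m)  ≡⟨ Hs.prefix-step-self E m e ⟨
    hs E (suc m)  ∎)
    where open ≤-Reasoning

  module _ {j} (1≤j : 1 ≤ j) (x≢j : ∀ y → ¬ Valley E j y) where

    no-H-step-from-diagonal : ∀ {m} → at E m ≡ just H → pt E m ≢ (j , j)
    no-H-step-from-diagonal {zero}  _ pt≡ = <⇒≢ 1≤j (cong proj₁ pt≡)
    no-H-step-from-diagonal {suc m} e pt≡ with at-defined E (n≤1+n m) e
    ... | V , e′ = x≢j j (m , (e′ , e) , pt≡)
    ... | H , e′ = H-step-not-onto-diagonal e′ (trans (cong proj₁ pt≡) (sym (cong proj₂ pt≡)))

    not-hill-end : ∀ {k} → at E k ≡ just V → pt E (suc k) ≡ (suc j , suc j) → ¬ (Σ ℕ λ m → suc m ≡ k × OneHillEndIdx E m)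
    not-hill-end vk pt≡ (m , refl , hm , _) = no-H-step-from-diagonal hm (H-step-start E m hm (V-step-start E (suc m) vk pt≡))

  pattern⇒return : ∀ {j} → ReturnPattern (Valley E) N j → ReturnNotHillEnd E (suc j)
  pattern⇒return {j} record { 1≤j = 1≤j ; j<N = j<N ; corner = corner ; x≢j = x≢j } with corner | V-step-at j<N
  ... | inj₂ (k , (vk , _) , pt≡) | _ = k , vk , pt≡ , not-hill-end 1≤j x≢j vk pt≡
  ... | inj₁ j+1≡N | q , vq , vs-q = q , vq , pt≡ , not-hill-end 1≤j x≢j vq pt≡
    where
    vs-fall : vs E (suc q) ≡ suc j
    vs-fall = trans (Vs.prefix-step-self E q vq) (cong suc vs-q)
    hs-fall : hs E (suc q) ≡ suc j
    hs-fall = ≤-antisym (subst (hs E (suc q) ≤_) (sym j+1≡N) (hs≤N (suc q))) (subst (_≤ hs E (suc q)) vs-fall (vs≤hs (suc q)))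
    pt≡ : pt E (suc q) ≡ (suc j , suc j)
    pt≡ = cong₂ _,_ vs-fall hs-fall

  return⇒pattern : ∀ {j} → ReturnNotHillEnd E (suc j) → ReturnPattern (Valley E) N j
  return⇒pattern (zero , v₀ , _) = ⊥-elim (H≢V (step-unique E 0 (starts-with-H v₀) v₀))
  return⇒pattern {j} (suc k , vk , pt≡ , not-hill) = record { 1≤j = 1≤j ; j<N = j<N ; corner = corner ; x≢j = x≢j }
    where
    before : pt E (suc k) ≡ (j , suc j)
    before = V-step-start E (suc k) vk pt≡

    v-before : at E k ≡ just V
    v-before with at-defined E (n≤1+n k) vk
    ... | V , e = e
    ... | H , e = ⊥-elim (not-hill (k , refl , e , vk , j , H-step-start E k e before))

    1≤j : 1 ≤ j
    1≤j = subst (1 ≤_) (trans (sym (Vs.prefix-step-self E k v-before)) (cong proj₁ before)) (s≤s z≤n)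

    j<N : j < N
    j<N = subst (_≤ N) (cong proj₁ pt≡) (vs≤N (suc (suc k)))

    corner : suc j ≡ N ⊎ Valley E (suc j) (suc j)
    corner with at E (suc (suc k)) in e
    ... | nothing = inj₁ (trans (sym (cong proj₁ pt≡)) (vs-end e))
    ... | just H  = inj₂ (suc k , (vk , e) , pt≡)
    ... | just V  = ⊥-elim (1+n≰n (begin
      suc (suc j)               ≡⟨ cong suc (cong proj₁ pt≡) ⟨
      suc (vs E (suc (suc k)))  ≡⟨ Vs.prefix-step-self E (suc (suc k)) e ⟨
      vs E (suc (suc (suc k)))  ≤⟨ vs≤hs (suc (suc (suc k))) ⟩
      hs E (suc (suc (suc k)))  ≡⟨ Hs.prefix-step E (suc (suc k)) e ⟩
      hs E (suc (suc k))        ≡⟨ cong proj₂ pt≡ ⟩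
      suc j                     ∎))
      where open ≤-Reasoning

    x≢j : ∀ y → ¬ Valley E j y
    x≢j y (k′ , (vk′ , hk′) , pt≡′) = H≢V (step-unique E (suc k) (subst (λ m → at E (suc m) ≡ just H) k′≡k hk′) vk)
      where
      k′≡k : k′ ≡ k
      k′≡k = Vs.prefix-injective E vk′ v-before (suc-injective (begin
        suc (vs E k′)  ≡⟨ Vs.prefix-step-self E k′ vk′ ⟨
        vs E (suc k′)  ≡⟨ cong proj₁ pt≡′ ⟩
        j              ≡⟨ cong proj₁ before ⟨
        vs E (suc k)   ≡⟨ Vs.prefix-step-self E k v-before ⟩
        suc (vs E k)   ∎))
        where open ≡-Reasoning

  return⇔pattern : ∀ {j} → ReturnNotHillEnd E (suc j) ⇔ ReturnPattern (Valley E) N j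
  return⇔pattern = mk⇔ return⇒pattern pattern⇒return

theorem3p14 : (N : ℕ) (D E : List Step) (c : ℕ → ℕ) (j : ℕ) →
    Dyck N D → AreaSeq N D c → IsLK N D E →
    (((Σ ℕ λ i → Rect D (suc i) j) → ReturnNotHillEnd E (suc j))
      × (ReturnNotHillEnd E (suc j) → Σ ℕ λ i → Rect D (suc i) j))
    × (∀ i → Rect D (suc i) j → suc j ≡ i + c i)
theorem3p14 N D E c j dyckD area (dyckE , lk-valleys) =
  (Equivalence.to rect⇔return , Equivalence.from rect⇔return) , λ _ → Rectangles.rect-area dyckD area
  where
  pair⇔valley : ∀ {x y} → Runs.LKPair D x y ⇔ Valley E x y
  pair⇔valley {x} {y} = mk⇔ (proj₂ (lk-valleys x y)) (proj₁ (lk-valleys x y))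

  rect⇔return : (Σ ℕ λ i → Rect D (suc i) j) ⇔ ReturnNotHillEnd E (suc j)
  rect⇔return = ⇔-sym (Returns.return⇔pattern dyckE) ⇔-∘ (ReturnPattern-cong pair⇔valley ⇔-∘ Rectangles.rect⇔pattern dyckD)
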